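{- Let $n>3$ be an integer such that $p=4n-1$ is prime. For integers $k$ put $\Gamma(k)=r_p((k-1)^2)+r_p(k+1-3n)$. Then \[\bigl|\{k\in\mathbb{Z}: 2\le k\le 2n,\ \Gamma(k)\ge p\}\bigr|=n,\qquad \bigl|\{k\in\mathbb{Z}: 2n+1\le k\le 4n,\ \Gamma(k)\ge p\}\bigr|=n-2.\]
   Context: For a positive integer $q$ and $x\in\mathbb{Z}$, $r_q(x)\in\{0,1,\dots,q-1\}$ denotes the remainder of $x$ upon division by $q$. -}

module Defs where

open import Data.Nat as ℕ using (ℕ; zero; suc; _∸_; _≤ᵇ_)
open import Data.Integer as ℤ using (ℤ; +_; _%ℕ_)
open import Data.List using (List; length; filter; map; upTo)

-- r q x : remainder of x modulo q, in {0,…,q-1} (only used for q > 0;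
-- the value for q = 0 is an irrelevant convention)
r : ℕ → ℤ → ℕ
r zero    x = 0
r (suc q) x = x %ℕ suc q

Γ : ℕ → ℤ → ℕ
Γ n k = r p ((k ℤ.- ℤ.1ℤ) ℤ.* (k ℤ.- ℤ.1ℤ)) ℕ.+ r p (k ℤ.+ ℤ.1ℤ ℤ.- (+ 3) ℤ.* (+ n))
  where p = 4 ℕ.* n ∸ 1

intRange : ℤ → ℤ → List ℤ
intRange a b = map (λ i → a ℤ.+ + i) (upTo (natPart ((b ℤ.+ ℤ.1ℤ) ℤ.- a)))
  where
  natPart : ℤ → ℕ
  natPart (+ m) = m
  natPart ℤ.-[1+ _ ] = 0

countΓ : ℕ → ℤ → ℤ → ℕ
countΓ n a b = length (filter (λ k → ℕ._≤?_ (4 ℕ.* n ∸ 1) (Γ n k)) (intRange a b))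

-- Put p = 4n - 1, A(k) = r_p((k-1)²) and B(k) = r_p(k+1-3n), so that Γ(k) = A(k) + B(k) < 2p.
-- From (k-1)² + (k+1-3n) = (k-2n)² + 1 + (k-n-1)p we get Γ(k) ≡ r_p((k-2n)²) + 1 (mod p), and
-- the right-hand side is below p because -1 is not a square modulo a prime p ≡ 3 (mod 4): if
-- x² ≡ -1 then Fermat gives x^(p+1) ≡ x² ≡ -1, whereas x^(p+1) = (x⁴)^((p+1)/4) ≡ 1. Hence
-- Γ(k) = r_p((k-2n)²) + 1 + p·[Γ(k) ≥ p], and summing over a range of k expresses p times the
-- count through the sums of A, of B and of r_p((k-2n)²). On each of the two ranges, k - 1 and
-- k - 2n run over the same squares modulo p up to the reflection x ↦ p - x and one endpoint
-- whose square is ≡ n, while B is explicit and piecewise linear; Gauss's formula then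
-- evaluates everything.

module Submission where

open import Data.Nat using (ℕ; suc; _<_; _*_; _∸_)
open import Data.Nat.Primality using (Prime)
open import Data.Integer using (+_)
open import Data.Product using (_×_)
open import Relation.Binary.PropositionalEquality using (_≡_)

open import Defs

open import Algebra.Bundles using (CommutativeSemiring)
import Algebra.Properties.CommutativeSemiring.Binomial as Binomial
import Algebra.Properties.Monoid.Sum as MonoidSum
import Algebra.Properties.Semiring.Exp as SemiringExp
import Algebra.Properties.Semiring.Mult as SemiringMult
import Data.Fin as Fin
open import Data.Fin using (Fin; toℕ; fromℕ; inject₁)
open import Data.Fin.Properties using (toℕ-fromℕ; toℕ-inject₁; toℕ<n)
import Data.Integer as ℤ
open import Data.Integer using (ℤ; -[1+_]; _⊖_; _%ℕ_; _/ℕ_)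
open import Data.Integer.DivMod using (a≡a%ℕn+[a/ℕn]*n; n%ℕd<d)
import Data.Integer.Properties as ℤ
open import Data.Integer.Tactic.RingSolver using () renaming (solve-∀ to ℤ-solve-∀)
open import Data.List using (length; filter; map; applyUpTo; upTo)
open import Data.List.Properties using (map-applyUpTo)
open import Data.Nat using (zero; _+_; _^_; _≤_; _%_; _!; NonZero; z<s; s<s; s≤s; s≤s⁻¹; _≤?_)
open import Data.Nat.Combinatorics using (_C_; nCk≡n!/k![n-k]!; k![n∸k]!∣n!; nCn≡1)
open import Data.Nat.DivMod
  using (_/_; m/n*n≡m; %-remove-+ˡ; %-distribˡ-+; %-distribˡ-*; m%n%n≡m%n; [m+kn]%n≡m%n; m%n<n; m<n⇒m%n≡m; m≤n⇒[n∸m]%m≡n%m)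
open import Data.Nat.Divisibility using (_∣_; _∤_; ∣1⇒≡1; ∣⇒≤; ∣-trans; _∣0; ∣m∣n⇒∣m+n; m∣m*n)
open import Data.Nat.Primality using (euclidsLemma; ¬prime[1])
open import Data.Nat.Properties
open import Algebra.Properties.CommutativeSemigroup +-commutativeSemigroup using () renaming (interchange to +-interchange)
open import Data.Nat.Tactic.RingSolver using (solve-∀)
open import Data.Product using (_,_)
open import Data.Sum using (inj₁; inj₂)
open import Function using (id; _∘_)
open import Relation.Binary.PropositionalEquality using (_≢_; refl; sym; trans; cong; cong₂; subst; module ≡-Reasoning)
open import Relation.Nullary using (Dec; yes; no; contradiction)
open import Relation.Unary using (Pred; Decidable)

-- Fermat's little theorem and the nonresidue -1

module _ {d : ℕ} .{{_ : NonZero d}} where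

  [m*[n%d]]%d≡[m*n]%d : ∀ m n → (m * (n % d)) % d ≡ (m * n) % d
  [m*[n%d]]%d≡[m*n]%d m n = begin
    (m * (n % d)) % d            ≡⟨ %-distribˡ-* m (n % d) d ⟩
    (m % d * (n % d % d)) % d    ≡⟨ cong (λ x → (m % d * x) % d) (m%n%n≡m%n n d) ⟩
    (m % d * (n % d)) % d        ≡⟨ %-distribˡ-* m n d ⟨
    (m * n) % d                  ∎
    where open ≡-Reasoning

  %-distribˡ-^ : ∀ m k → m ^ k % d ≡ (m % d) ^ k % d
  %-distribˡ-^ m zero    = refl
  %-distribˡ-^ m (suc k) = begin
    (m * m ^ k) % d                    ≡⟨ %-distribˡ-* m (m ^ k) d ⟩
    (m % d * (m ^ k % d)) % d          ≡⟨ cong (λ x → (m % d * x) % d) (%-distribˡ-^ m k) ⟩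
    (m % d * ((m % d) ^ k % d)) % d    ≡⟨ [m*[n%d]]%d≡[m*n]%d (m % d) ((m % d) ^ k) ⟩
    (m % d * (m % d) ^ k) % d          ∎
    where open ≡-Reasoning

module Fermat (q : ℕ) (isPrime : Prime (suc q)) where

  private
    p : ℕ
    p = suc q

  m<p⇒p∤m! : ∀ {m} → m < p → p ∤ m !
  m<p⇒p∤m! {zero}  _   p∣1  = contradiction (subst Prime (∣1⇒≡1 p∣1) isPrime) ¬prime[1]
  m<p⇒p∤m! {suc m} m<p p∣m! with euclidsLemma (suc m) (m !) isPrime p∣m!
  ... | inj₁ p∣1+m = <⇒≱ m<p (∣⇒≤ p∣1+m)
  ... | inj₂ p∣m!′ = m<p⇒p∤m! (<-trans (n<1+n m) m<p) p∣m!′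

  p∣pCk : ∀ {k} → 0 < k → k < p → p ∣ p C k
  p∣pCk {k} 0<k k<p with euclidsLemma (p C k) (k ! * (p ∸ k) !) isPrime p∣pCk*k![p∸k]!
    where
    instance
      k!*[p∸k]!≢0 : NonZero (k ! * (p ∸ k) !)
      k!*[p∸k]!≢0 = k !* (p ∸ k) !≢0
    p∣pCk*k![p∸k]! : p ∣ (p C k) * (k ! * (p ∸ k) !)
    p∣pCk*k![p∸k]! = subst (p ∣_) (sym (begin
      (p C k) * (k ! * (p ∸ k) !)                  ≡⟨ cong (_* (k ! * (p ∸ k) !)) (nCk≡n!/k![n-k]! (<⇒≤ k<p)) ⟩
      p ! / (k ! * (p ∸ k) !) * (k ! * (p ∸ k) !) ≡⟨ m/n*n≡m (k![n∸k]!∣n! (<⇒≤ k<p)) ⟩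
      p !                                        ∎)) (m∣m*n (q !))
      where open ≡-Reasoning
  ... | inj₁ p∣pCk′ = p∣pCk′
  ... | inj₂ p∣k![p∸k]! with euclidsLemma (k !) ((p ∸ k) !) isPrime p∣k![p∸k]!
  ...   | inj₁ p∣k!      = contradiction p∣k! (m<p⇒p∤m! k<p)
  ...   | inj₂ p∣[p∸k]! = contradiction p∣[p∸k]! (m<p⇒p∤m! (∸-monoʳ-< 0<k (<⇒≤ k<p)))

  private
    open CommutativeSemiring +-*-commutativeSemiring using (semiring)
    open Binomial +-*-commutativeSemiring using (binomialTerm; theorem)
    open SemiringExp semiring renaming (_^_ to _^′_)
    open SemiringMult semiring renaming (_×_ to _×′_)
    open MonoidSum +-0-monoid using (sum; sum-init-last)

    ^′≡^ : ∀ x k → x ^′ k ≡ x ^ k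
    ^′≡^ x zero    = refl
    ^′≡^ x (suc k) = cong (x *_) (^′≡^ x k)

    ×′≡* : ∀ k x → k ×′ x ≡ k * x
    ×′≡* zero    x = refl
    ×′≡* (suc k) x = cong (λ s → x + s) (×′≡* k x)

    ∣-sum : ∀ {d m} (t : Fin m → ℕ) → (∀ i → d ∣ t i) → d ∣ sum t
    ∣-sum {d} {zero}  t d∣t = d ∣0
    ∣-sum {m = suc m} t d∣t = ∣m∣n⇒∣m+n (d∣t Fin.zero) (∣-sum (λ i → t (Fin.suc i)) (λ i → d∣t (Fin.suc i)))

    term : ℕ → Fin (suc p) → ℕ
    term a = binomialTerm 1 a p

    term-first : ∀ a → term a Fin.zero ≡ a ^ p
    term-first a = trans (×′≡* 1 _) (trans (+-identityʳ _) (trans (*-identityˡ _) (^′≡^ a p)))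

    term-last : ∀ a → term a (fromℕ p) ≡ 1
    term-last a rewrite toℕ-fromℕ q | nCn≡1 p | n∸n≡0 q =
      trans (×′≡* 1 _) (trans (+-identityʳ _) (trans (*-identityʳ _) (trans (^′≡^ 1 p) (^-zeroˡ p))))

    p∣term : ∀ a (k : Fin q) → p ∣ term a (Fin.suc (inject₁ k))
    p∣term a k = subst (p ∣_) (sym (×′≡* (p C suc (toℕ (inject₁ k))) _))
      (∣-trans (p∣pCk z<s (s<s (subst (_< q) (sym (toℕ-inject₁ k)) (toℕ<n k)))) (m∣m*n _))

  [1+a]^p%p≡[1+a^p]%p : ∀ a → suc a ^ p % p ≡ suc (a ^ p) % p
  [1+a]^p%p≡[1+a^p]%p a = begin
    suc a ^ p % p                                   ≡⟨ cong (_% p) (sym (^′≡^ (1 + a) p)) ⟩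
    (1 + a) ^′ p % p                                 ≡⟨ cong (_% p) (theorem p 1 a) ⟩
    (term a Fin.zero + sum (λ k → term a (Fin.suc k))) % p
                                                     ≡⟨ cong (λ s → (term a Fin.zero + s) % p) (sum-init-last (λ k → term a (Fin.suc k))) ⟩
    (term a Fin.zero + (middle + term a (fromℕ p))) % p ≡⟨ cong₂ (λ x y → (x + (middle + y)) % p) (term-first a) (term-last a) ⟩
    (a ^ p + (middle + 1)) % p                       ≡⟨ cong (_% p) (x+[y+1]≡y+[1+x] (a ^ p) middle) ⟩
    (middle + suc (a ^ p)) % p                       ≡⟨ %-remove-+ˡ (suc (a ^ p)) (∣-sum _ (p∣term a)) ⟩
    suc (a ^ p) % p                                  ∎
    where
    open ≡-Reasoning
    middle : ℕ
    middle = sum (λ k → term a (Fin.suc (inject₁ k)))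
    x+[y+1]≡y+[1+x] : ∀ x y → x + (y + 1) ≡ y + suc x
    x+[y+1]≡y+[1+x] x y = trans (+-comm x (y + 1)) (+-assoc y 1 x)

  fermat : ∀ a → a ^ p % p ≡ a % p
  fermat zero    = refl
  fermat (suc a) = begin
    suc a ^ p % p            ≡⟨ [1+a]^p%p≡[1+a^p]%p a ⟩
    (1 + a ^ p) % p          ≡⟨ %-distribˡ-+ 1 (a ^ p) p ⟩
    (1 % p + a ^ p % p) % p  ≡⟨ cong (λ x → (1 % p + x) % p) (fermat a) ⟩
    (1 % p + a % p) % p      ≡⟨ %-distribˡ-+ 1 a p ⟨
    suc a % p                ∎
    where open ≡-Reasoning

module _ {m : ℕ} (isPrime : Prime (3 + 4 * m)) where

  private
    p : ℕ
    p = 3 + 4 * m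

  x*x%p≢p∸1 : ∀ x → x * x % p ≢ p ∸ 1
  x*x%p≢p∸1 x x*x%p≡p∸1 = contradiction (trans (sym x^[p+1]%p≡p∸1) x^[p+1]%p≡1) λ ()
    where
    open ≡-Reasoning
    open Fermat (2 + 4 * m) isPrime using (fermat)

    x^[p+1]%p≡p∸1 : x ^ suc p % p ≡ p ∸ 1
    x^[p+1]%p≡p∸1 = begin
      (x * x ^ p) % p        ≡⟨ [m*[n%d]]%d≡[m*n]%d x (x ^ p) ⟨
      (x * (x ^ p % p)) % p  ≡⟨ cong (λ y → (x * y) % p) (fermat x) ⟩
      (x * (x % p)) % p      ≡⟨ [m*[n%d]]%d≡[m*n]%d x x ⟩
      x * x % p              ≡⟨ x*x%p≡p∸1 ⟩
      p ∸ 1                  ∎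

    x^[p+1]%p≡1 : x ^ suc p % p ≡ 1
    x^[p+1]%p≡1 = begin
      x ^ suc p % p                          ≡⟨ cong (_% p) (x^[4+4m]≡[x*x*[x*x]]^[1+m]) ⟩
      (x * x * (x * x)) ^ suc m % p          ≡⟨ %-distribˡ-^ (x * x * (x * x)) (suc m) ⟩
      ((x * x * (x * x)) % p) ^ suc m % p    ≡⟨ cong (λ y → y ^ suc m % p) x⁴%p≡1 ⟩
      1 ^ suc m % p                          ≡⟨ cong (_% p) (^-zeroˡ (suc m)) ⟩
      1                                      ∎
      where
      x^[4+4m]≡[x*x*[x*x]]^[1+m] : x ^ suc p ≡ (x * x * (x * x)) ^ suc m
      x^[4+4m]≡[x*x*[x*x]]^[1+m] = begin
        x ^ (4 + 4 * m)             ≡⟨ cong (x ^_) (*-suc 4 m) ⟨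
        x ^ (4 * suc m)             ≡⟨ ^-*-assoc x 4 (suc m) ⟨
        (x ^ 4) ^ suc m             ≡⟨ cong (_^ suc m) (x^4≡x*x*[x*x] x) ⟩
        (x * x * (x * x)) ^ suc m   ∎
        where
        x^4≡x*x*[x*x] : ∀ x → x * (x * (x * (x * 1))) ≡ x * x * (x * x)
        x^4≡x*x*[x*x] = solve-∀
      x⁴%p≡1 : (x * x * (x * x)) % p ≡ 1
      x⁴%p≡1 = begin
        (x * x * (x * x)) % p                ≡⟨ %-distribˡ-* (x * x) (x * x) p ⟩
        (x * x % p * (x * x % p)) % p        ≡⟨ cong (λ y → (y * y) % p) x*x%p≡p∸1 ⟩
        ((2 + 4 * m) * (2 + 4 * m)) % p      ≡⟨ cong (_% p) ([p∸1]*[p∸1]≡1+[p∸2]*p m) ⟩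
        (1 + (1 + 4 * m) * p) % p            ≡⟨ [m+kn]%n≡m%n 1 (1 + 4 * m) p ⟩
        1                                    ∎
        where
        [p∸1]*[p∸1]≡1+[p∸2]*p : ∀ m → (2 + 4 * m) * (2 + 4 * m) ≡ 1 + (1 + 4 * m) * (3 + 4 * m)
        [p∸1]*[p∸1]≡1+[p∸2]*p = solve-∀

  [x*x+1]%p≡x*x%p+1 : ∀ x → (x * x + 1) % p ≡ x * x % p + 1
  [x*x+1]%p≡x*x%p+1 x = trans (%-distribˡ-+ (x * x) 1 p) (m<n⇒m%n≡m x*x%p+1<p)
    where
    x*x%p<p∸1 : x * x % p < p ∸ 1
    x*x%p<p∸1 = ≤∧≢⇒< (s≤s⁻¹ (m%n<n (x * x) p)) (x*x%p≢p∸1 x)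
    x*x%p+1<p : x * x % p + 1 < p
    x*x%p+1<p = subst (_< p) (+-comm 1 (x * x % p)) (s≤s x*x%p<p∸1)

-- Remainders of integers

module _ {d : ℕ} .{{_ : NonZero d}} where

  i≡e+z*d⇒i%ℕd≡e%d : ∀ i e z → i ≡ + e ℤ.+ z ℤ.* + d → i %ℕ d ≡ e % d
  i≡e+z*d⇒i%ℕd≡e%d i e z i≡e+zd = sym (e%d≡ρ (i /ℕ d ℤ.- z) e≡ρ+[q-z]d)
    where
    open ≡-Reasoning
    ρ : ℕ
    ρ = i %ℕ d

    e≡ρ+[q-z]d : + e ≡ + ρ ℤ.+ (i /ℕ d ℤ.- z) ℤ.* + d
    e≡ρ+[q-z]d = begin
      + e                                       ≡⟨ a≡a+b*c-b*c (+ e) z (+ d) ⟩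
      + e ℤ.+ z ℤ.* + d ℤ.- z ℤ.* + d           ≡⟨ cong (ℤ._- z ℤ.* + d) i≡e+zd ⟨
      i ℤ.- z ℤ.* + d                           ≡⟨ cong (ℤ._- z ℤ.* + d) (a≡a%ℕn+[a/ℕn]*n i d) ⟩
      + ρ ℤ.+ i /ℕ d ℤ.* + d ℤ.- z ℤ.* + d      ≡⟨ a+b*c-z*c≡a+[b-z]*c (+ ρ) (i /ℕ d) z (+ d) ⟩
      + ρ ℤ.+ (i /ℕ d ℤ.- z) ℤ.* + d            ∎
      where
      a≡a+b*c-b*c : ∀ a b c → a ≡ a ℤ.+ b ℤ.* c ℤ.- b ℤ.* c
      a≡a+b*c-b*c = ℤ-solve-∀
      a+b*c-z*c≡a+[b-z]*c : ∀ a b z c → a ℤ.+ b ℤ.* c ℤ.- z ℤ.* c ≡ a ℤ.+ (b ℤ.- z) ℤ.* c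
      a+b*c-z*c≡a+[b-z]*c = ℤ-solve-∀

    e%d≡ρ : ∀ w → + e ≡ + ρ ℤ.+ w ℤ.* + d → e % d ≡ ρ
    e%d≡ρ (+ s) e≡ρ+sd = begin
      e % d             ≡⟨ cong (_% d) (ℤ.+-injective (trans e≡ρ+sd (cong (λ x → + ρ ℤ.+ x) (sym (ℤ.pos-* s d))))) ⟩
      (ρ + s * d) % d   ≡⟨ [m+kn]%n≡m%n ρ s d ⟩
      ρ % d             ≡⟨ m<n⇒m%n≡m (n%ℕd<d i d) ⟩
      ρ                 ∎
    e%d≡ρ -[1+ s ] e≡ρ-[1+s]d = contradiction (n%ℕd<d i d) (≤⇒≯ d≤ρ)
      where
      ρ≡e+[1+s]d : ρ ≡ e + suc s * d
      ρ≡e+[1+s]d = ℤ.+-injective (begin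
        + ρ                                        ≡⟨ a≡a+[-b]*c+b*c (+ ρ) (+ suc s) (+ d) ⟩
        + ρ ℤ.+ -[1+ s ] ℤ.* + d ℤ.+ + suc s ℤ.* + d ≡⟨ cong₂ ℤ._+_ e≡ρ-[1+s]d (ℤ.pos-* (suc s) d) ⟨
        + (e + suc s * d)                          ∎)
        where
        a≡a+[-b]*c+b*c : ∀ a b c → a ≡ a ℤ.+ (ℤ.- b) ℤ.* c ℤ.+ b ℤ.* c
        a≡a+[-b]*c+b*c = ℤ-solve-∀
      d≤ρ : d ≤ ρ
      d≤ρ = subst (d ≤_) (sym ρ≡e+[1+s]d) (≤-trans (m≤n*m d (suc s)) (m≤n+m (suc s * d) e))

  %ℕ-distribˡ-+ : ∀ i j → (i ℤ.+ j) %ℕ d ≡ (i %ℕ d + j %ℕ d) % d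
  %ℕ-distribˡ-+ i j = i≡e+z*d⇒i%ℕd≡e%d (i ℤ.+ j) (i %ℕ d + j %ℕ d) (i /ℕ d ℤ.+ j /ℕ d) (begin
    i ℤ.+ j                                                          ≡⟨ cong₂ ℤ._+_ (a≡a%ℕn+[a/ℕn]*n i d) (a≡a%ℕn+[a/ℕn]*n j d) ⟩
    (+ (i %ℕ d) ℤ.+ i /ℕ d ℤ.* + d) ℤ.+ (+ (j %ℕ d) ℤ.+ j /ℕ d ℤ.* + d) ≡⟨ [a+b*c]+[a′+b′*c]≡[a+a′]+[b+b′]*c (+ (i %ℕ d)) (i /ℕ d) (+ (j %ℕ d)) (j /ℕ d) (+ d) ⟩
    + (i %ℕ d + j %ℕ d) ℤ.+ (i /ℕ d ℤ.+ j /ℕ d) ℤ.* + d               ∎)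
    where
    open ≡-Reasoning
    [a+b*c]+[a′+b′*c]≡[a+a′]+[b+b′]*c : ∀ a b a′ b′ c → (a ℤ.+ b ℤ.* c) ℤ.+ (a′ ℤ.+ b′ ℤ.* c) ≡ (a ℤ.+ a′) ℤ.+ (b ℤ.+ b′) ℤ.* c
    [a+b*c]+[a′+b′*c]≡[a+a′]+[b+b′]*c = ℤ-solve-∀

i*i≡+∣i∣*∣i∣ : ∀ i → i ℤ.* i ≡ + (ℤ.∣ i ∣ * ℤ.∣ i ∣)
i*i≡+∣i∣*∣i∣ (+ m)    = ℤ.+◃n≡+n (m * m)
i*i≡+∣i∣*∣i∣ -[1+ m ] = refl

∣m⊖[m+n]∣≡n : ∀ m n → ℤ.∣ m ⊖ (m + n) ∣ ≡ n
∣m⊖[m+n]∣≡n m n = trans (ℤ.∣⊖∣-≤ (m≤m+n m n)) (m+n∸m≡n m n)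

∣[m+n]⊖m∣≡n : ∀ m n → ℤ.∣ (m + n) ⊖ m ∣ ≡ n
∣[m+n]⊖m∣≡n m n = trans (ℤ.∣m⊖n∣≡∣n⊖m∣ (m + n) m) (∣m⊖[m+n]∣≡n m n)

m≡n+o⇒+m-+n≡+o : ∀ {m n o} → m ≡ n + o → + m ℤ.+ ℤ.- + n ≡ + o
m≡n+o⇒+m-+n≡+o {m} {n} {o} m≡n+o = begin
  + m ℤ.+ ℤ.- + n ≡⟨ ℤ.m-n≡m⊖n m n ⟩
  m ⊖ n           ≡⟨ cong (_⊖ n) m≡n+o ⟩
  (n + o) ⊖ n     ≡⟨ ℤ.⊖-≥ (m≤m+n n o) ⟩
  + (n + o ∸ n)   ≡⟨ cong +_ (m+n∸m≡n n o) ⟩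
  + o             ∎
  where open ≡-Reasoning

-- Finite sums and counting

∑< : ℕ → (ℕ → ℕ) → ℕ
∑< zero    f = 0
∑< (suc m) f = f 0 + ∑< m (λ i → f (suc i))

syntax ∑< m (λ i → e) = ∑[ i < m ] e

∑<-cong : ∀ m {f g : ℕ → ℕ} → (∀ {i} → i < m → f i ≡ g i) → ∑< m f ≡ ∑< m g
∑<-cong zero    f≡g = refl
∑<-cong (suc m) f≡g = cong₂ _+_ (f≡g z<s) (∑<-cong m (λ i<m → f≡g (s<s i<m)))

∑<-distrib-+ : ∀ m (f g : ℕ → ℕ) → ∑[ i < m ] (f i + g i) ≡ ∑< m f + ∑< m g
∑<-distrib-+ zero    f g = refl
∑<-distrib-+ (suc m) f g = trans (cong (λ s → f 0 + g 0 + s) (∑<-distrib-+ m _ _)) (+-interchange (f 0) _ _ _)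

*-distribˡ-∑< : ∀ m c (f : ℕ → ℕ) → ∑[ i < m ] (c * f i) ≡ c * ∑< m f
*-distribˡ-∑< zero    c f = sym (*-zeroʳ c)
*-distribˡ-∑< (suc m) c f = trans (cong (λ s → c * f 0 + s) (*-distribˡ-∑< m c _)) (sym (*-distribˡ-+ c (f 0) _))

∑<-const : ∀ m c → ∑[ _ < m ] c ≡ m * c
∑<-const zero    c = refl
∑<-const (suc m) c = cong (λ s → c + s) (∑<-const m c)

∑<-suc : ∀ m (f : ℕ → ℕ) → ∑< (suc m) f ≡ ∑< m f + f m
∑<-suc zero    f = +-comm (f 0) 0
∑<-suc (suc m) f = trans (cong (λ s → f 0 + s) (∑<-suc m _)) (sym (+-assoc (f 0) _ _))

∑<-reverse : ∀ m (f : ℕ → ℕ) → ∑[ i < m ] f (m ∸ suc i) ≡ ∑< m f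
∑<-reverse zero    f = refl
∑<-reverse (suc m) f = begin
  f m + ∑[ i < m ] f (m ∸ suc i) ≡⟨ cong (λ s → f m + s) (∑<-reverse m f) ⟩
  f m + ∑< m f                   ≡⟨ +-comm (f m) _ ⟩
  ∑< m f + f m                   ≡⟨ ∑<-suc m f ⟨
  ∑< (suc m) f                   ∎
  where open ≡-Reasoning

∑<-+ : ∀ m n (f : ℕ → ℕ) → ∑< (m + n) f ≡ ∑< m f + ∑[ i < n ] f (m + i)
∑<-+ zero    n f = refl
∑<-+ (suc m) n f = trans (cong (λ s → f 0 + s) (∑<-+ m n _)) (sym (+-assoc (f 0) _ _))

∑[i<m]i*2+m≡m*m : ∀ m → ∑[ i < m ] i * 2 + m ≡ m * m
∑[i<m]i*2+m≡m*m zero    = refl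
∑[i<m]i*2+m≡m*m (suc m) = begin
  ∑< (suc m) id * 2 + suc m          ≡⟨ cong (λ s → s * 2 + suc m) (∑<-suc m id) ⟩
  (∑< m id + m) * 2 + suc m          ≡⟨ [s+m]*2+[1+m]≡[s*2+m]+[m+[1+m]] (∑< m id) m ⟩
  (∑< m id * 2 + m) + (m + suc m)    ≡⟨ cong (_+ (m + suc m)) (∑[i<m]i*2+m≡m*m m) ⟩
  m * m + (m + suc m)                ≡⟨ m*m+[m+[1+m]]≡[1+m]*[1+m] m ⟩
  suc m * suc m                      ∎
  where
  open ≡-Reasoning
  [s+m]*2+[1+m]≡[s*2+m]+[m+[1+m]] : ∀ s m → (s + m) * 2 + suc m ≡ (s * 2 + m) + (m + suc m)
  [s+m]*2+[1+m]≡[s*2+m]+[m+[1+m]] = solve-∀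
  m*m+[m+[1+m]]≡[1+m]*[1+m] : ∀ m → m * m + (m + suc m) ≡ suc m * suc m
  m*m+[m+[1+m]]≡[1+m]*[1+m] = solve-∀

𝟙[_] : ∀ {a} {A : Set a} → Dec A → ℕ
𝟙[ yes _ ] = 1
𝟙[ no  _ ] = 0

m+n≡[m+n]%d+d*𝟙[d≤m+n] : ∀ {d} .{{_ : NonZero d}} {m n} → m < d → n < d →
                          m + n ≡ (m + n) % d + d * 𝟙[ d ≤? m + n ]
m+n≡[m+n]%d+d*𝟙[d≤m+n] {d} {m = m} {n} m<d n<d with d ≤? m + n
... | yes d≤m+n = begin
  m + n                  ≡⟨ m∸n+n≡m d≤m+n ⟨
  m + n ∸ d + d          ≡⟨ cong₂ _+_ (m<n⇒m%n≡m m+n∸d<d) (*-identityʳ d) ⟨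
  (m + n ∸ d) % d + d * 1 ≡⟨ cong (_+ d * 1) (m≤n⇒[n∸m]%m≡n%m d≤m+n) ⟩
  (m + n) % d + d * 1    ∎
  where
  open ≡-Reasoning
  m+n∸d<d : m + n ∸ d < d
  m+n∸d<d = subst (m + n ∸ d <_) (m+n∸n≡m d d) (∸-monoˡ-< (+-mono-< m<d n<d) d≤m+n)
... | no  d≰m+n = begin
  m + n                  ≡⟨ m<n⇒m%n≡m (≰⇒> d≰m+n) ⟨
  (m + n) % d            ≡⟨ +-identityʳ _ ⟨
  (m + n) % d + 0        ≡⟨ cong (λ s → (m + n) % d + s) (*-zeroʳ d) ⟨
  (m + n) % d + d * 0    ∎
  where open ≡-Reasoning

length-filter-applyUpTo : ∀ {a ℓ} {A : Set a} {P : Pred A ℓ} (P? : Decidable P) (f : ℕ → A) m →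
                          length (filter P? (applyUpTo f m)) ≡ ∑[ i < m ] 𝟙[ P? (f i) ]
length-filter-applyUpTo P? f zero    = refl
length-filter-applyUpTo P? f (suc m) with P? (f 0)
... | yes _ = cong suc (length-filter-applyUpTo P? (f ∘ suc) m)
... | no  _ = length-filter-applyUpTo P? (f ∘ suc) m

intRange-upTo : ∀ a b m → b + 1 ≡ a + m → intRange (+ a) (+ b) ≡ map (λ i → + a ℤ.+ + i) (upTo m)
intRange-upTo a b m b+1≡a+m with + (b + 1) ℤ.+ ℤ.- + a | m≡n+o⇒+m-+n≡+o {b + 1} {a} {m} b+1≡a+m
... | _ | refl = refl

-- The function Γ

-- Γ and countΓ with the modulus abstracted: Γ n ≡ Γ′ (4 * n ∸ 1) n by definition, and
-- for a modulus of the form 3 + 4 * m the remainder r computes to _%ℕ_.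
Γ′ : ℕ → ℕ → ℤ → ℕ
Γ′ p n k = r p ((k ℤ.- ℤ.1ℤ) ℤ.* (k ℤ.- ℤ.1ℤ)) + r p (k ℤ.+ ℤ.1ℤ ℤ.- + 3 ℤ.* + n)

countΓ′ : ℕ → ℕ → ℤ → ℤ → ℕ
countΓ′ p n a b = length (filter (λ k → p ≤? Γ′ p n k) (intRange a b))

countΓ′≡∑ : ∀ p n a b m → b + 1 ≡ a + m →
            countΓ′ p n (+ a) (+ b) ≡ ∑[ i < m ] 𝟙[ p ≤? Γ′ p n (+ a ℤ.+ + i) ]
countΓ′≡∑ p n a b m b+1≡a+m = begin
  length (filter P? (intRange (+ a) (+ b)))              ≡⟨ cong (length ∘ filter P?) (intRange-upTo a b m b+1≡a+m) ⟩
  length (filter P? (map (λ i → + a ℤ.+ + i) (upTo m)))  ≡⟨ cong (length ∘ filter P?) (map-applyUpTo id (λ i → + a ℤ.+ + i) m) ⟩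
  length (filter P? (applyUpTo (λ i → + a ℤ.+ + i) m))   ≡⟨ length-filter-applyUpTo P? (λ i → + a ℤ.+ + i) m ⟩
  ∑[ i < m ] 𝟙[ P? (+ a ℤ.+ + i) ]                       ∎
  where
  open ≡-Reasoning
  P? : (k : ℤ) → Dec (p ≤ Γ′ p n k)
  P? k = p ≤? Γ′ p n k

module Γ-Properties {m : ℕ} (isPrime : Prime (3 + 4 * m)) where

  p n : ℕ
  p = 3 + 4 * m
  n = suc m

  sq : ℕ → ℕ
  sq x = x * x % p

  Γ′%p≡sq+1 : ∀ k → Γ′ p n k % p ≡ sq ℤ.∣ k ℤ.- + (2 * n) ∣ + 1
  Γ′%p≡sq+1 k = begin
    (X %ℕ p + Y %ℕ p) % p  ≡⟨ %ℕ-distribˡ-+ X Y ⟨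
    (X ℤ.+ Y) %ℕ p         ≡⟨ i≡e+z*d⇒i%ℕd≡e%d (X ℤ.+ Y) (s * s + 1) (k ℤ.- + n ℤ.- ℤ.1ℤ) X+Y≡s*s+1+[k-n-1]p ⟩
    (s * s + 1) % p        ≡⟨ [x*x+1]%p≡x*x%p+1 {m} isPrime s ⟩
    sq s + 1               ∎
    where
    open ≡-Reasoning
    X Y D : ℤ
    X = (k ℤ.- ℤ.1ℤ) ℤ.* (k ℤ.- ℤ.1ℤ)
    Y = k ℤ.+ ℤ.1ℤ ℤ.- + 3 ℤ.* + n
    D = k ℤ.- + (2 * n)
    s : ℕ
    s = ℤ.∣ D ∣

    [k-1]²+[k+1-3n]≡[k-2n]²+1+[k-n-1][4n-1] : ∀ k n → (k ℤ.- ℤ.1ℤ) ℤ.* (k ℤ.- ℤ.1ℤ) ℤ.+ (k ℤ.+ ℤ.1ℤ ℤ.- + 3 ℤ.* n)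
               ≡ (k ℤ.- + 2 ℤ.* n) ℤ.* (k ℤ.- + 2 ℤ.* n) ℤ.+ ℤ.1ℤ ℤ.+ (k ℤ.- n ℤ.- ℤ.1ℤ) ℤ.* (+ 4 ℤ.* n ℤ.- ℤ.1ℤ)
    [k-1]²+[k+1-3n]≡[k-2n]²+1+[k-n-1][4n-1] = ℤ-solve-∀

    X+Y≡s*s+1+[k-n-1]p : X ℤ.+ Y ≡ + (s * s + 1) ℤ.+ (k ℤ.- + n ℤ.- ℤ.1ℤ) ℤ.* + p
    X+Y≡s*s+1+[k-n-1]p = begin
      X ℤ.+ Y                                                           ≡⟨ [k-1]²+[k+1-3n]≡[k-2n]²+1+[k-n-1][4n-1] k (+ n) ⟩
      D ℤ.* D ℤ.+ ℤ.1ℤ ℤ.+ (k ℤ.- + n ℤ.- ℤ.1ℤ) ℤ.* (+ 4 ℤ.* + n ℤ.- ℤ.1ℤ) ≡⟨ cong₂ (λ a b → a ℤ.+ ℤ.1ℤ ℤ.+ (k ℤ.- + n ℤ.- ℤ.1ℤ) ℤ.* b)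
                                                                             (i*i≡+∣i∣*∣i∣ D) (cong (λ x → + (x ∸ 1)) (*-suc 4 m)) ⟩
      + (s * s + 1) ℤ.+ (k ℤ.- + n ℤ.- ℤ.1ℤ) ℤ.* + p                     ∎

  Γ′≡sq+1+p*𝟙 : ∀ k → Γ′ p n k ≡ sq ℤ.∣ k ℤ.- + (2 * n) ∣ + 1 + p * 𝟙[ p ≤? Γ′ p n k ]
  Γ′≡sq+1+p*𝟙 k = trans (m+n≡[m+n]%d+d*𝟙[d≤m+n] (n%ℕd<d ((k ℤ.- ℤ.1ℤ) ℤ.* (k ℤ.- ℤ.1ℤ)) p)
                                                (n%ℕd<d (k ℤ.+ ℤ.1ℤ ℤ.- + 3 ℤ.* + n) p))
                        (cong (_+ p * 𝟙[ p ≤? Γ′ p n k ]) (Γ′%p≡sq+1 k))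

  ∑Γ′≡∑[sq+1]+p*countΓ′ : ∀ a b l → b + 1 ≡ a + l →
    ∑[ i < l ] Γ′ p n (+ a ℤ.+ + i) ≡ ∑[ i < l ] (sq ℤ.∣ + a ℤ.+ + i ℤ.- + (2 * n) ∣ + 1) + p * countΓ′ p n (+ a) (+ b)
  ∑Γ′≡∑[sq+1]+p*countΓ′ a b l b+1≡a+l = begin
    ∑[ i < l ] Γ′ p n (k i)                           ≡⟨ ∑<-cong l (λ {i} _ → Γ′≡sq+1+p*𝟙 (k i)) ⟩
    ∑[ i < l ] (sq+1 i + p * 𝟙[ P? (k i) ])          ≡⟨ ∑<-distrib-+ l sq+1 (λ i → p * 𝟙[ P? (k i) ]) ⟩
    ∑< l sq+1 + ∑[ i < l ] (p * 𝟙[ P? (k i) ])       ≡⟨ cong (λ s → ∑< l sq+1 + s) (*-distribˡ-∑< l p (λ i → 𝟙[ P? (k i) ])) ⟩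
    ∑< l sq+1 + p * ∑[ i < l ] 𝟙[ P? (k i) ]         ≡⟨ cong (λ c → ∑< l sq+1 + p * c) (countΓ′≡∑ p n a b l b+1≡a+l) ⟨
    ∑< l sq+1 + p * countΓ′ p n (+ a) (+ b)          ∎
    where
    open ≡-Reasoning
    k : ℕ → ℤ
    k i = + a ℤ.+ + i
    sq+1 : ℕ → ℕ
    sq+1 i = sq ℤ.∣ k i ℤ.- + (2 * n) ∣ + 1
    P? : (j : ℤ) → Dec (p ≤ Γ′ p n j)
    P? j = p ≤? Γ′ p n j

  a+b≡p⇒sq[a]≡sq[b] : ∀ a b → a + b ≡ p → sq a ≡ sq b
  a+b≡p⇒sq[a]≡sq[b] a b a+b≡p = begin
    a * a % p              ≡⟨ [m+kn]%n≡m%n (a * a) b p ⟨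
    (a * a + b * p) % p    ≡⟨ cong (λ q → (a * a + b * q) % p) a+b≡p ⟨
    (a * a + b * (a + b)) % p ≡⟨ cong (_% p) (a*a+b*[a+b]≡b*b+a*[a+b] a b) ⟩
    (b * b + a * (a + b)) % p ≡⟨ cong (λ q → (b * b + a * q) % p) a+b≡p ⟩
    (b * b + a * p) % p    ≡⟨ [m+kn]%n≡m%n (b * b) a p ⟩
    b * b % p              ∎
    where
    open ≡-Reasoning
    a*a+b*[a+b]≡b*b+a*[a+b] : ∀ a b → a * a + b * (a + b) ≡ b * b + a * (a + b)
    a*a+b*[a+b]≡b*b+a*[a+b] = solve-∀

-- Here n = L + 2; the lower range is k = 2 + i with i < h = 2n - 1, the upper range is
-- k = 2n + 1 + i with i < 2n.
module Counts (L : ℕ) (isPrime : Prime (3 + 4 * suc L)) where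

  open Γ-Properties {suc L} isPrime

  n<p : n < p
  n<p = +-monoʳ-≤ 3 (≤-trans (n≤1+n L) (m≤n*m (suc L) 4))

  [x+p*c]*2+y≡[x+p*d]*2+y⇒c≡d : ∀ {c d} x y → (x + p * c) * 2 + y ≡ (x + p * d) * 2 + y → c ≡ d
  [x+p*c]*2+y≡[x+p*d]*2+y⇒c≡d {c} {d} x y eq =
    *-cancelˡ-≡ c d p (+-cancelˡ-≡ x _ _ (*-cancelʳ-≡ _ _ 2 (+-cancelʳ-≡ y _ _ eq)))

  h : ℕ
  h = 3 + 2 * L

  sq[h]≡n : sq h ≡ n
  sq[h]≡n = begin
    h * h % p                ≡⟨ cong (_% p) (h*h≡n+[1+L]*p L) ⟩
    (n + (1 + L) * p) % p    ≡⟨ [m+kn]%n≡m%n n (1 + L) p ⟩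
    n % p                    ≡⟨ m<n⇒m%n≡m n<p ⟩
    n                        ∎
    where
    open ≡-Reasoning
    h*h≡n+[1+L]*p : ∀ L → (3 + 2 * L) * (3 + 2 * L) ≡ (2 + L) + (1 + L) * (3 + 4 * suc L)
    h*h≡n+[1+L]*p = solve-∀

  r[k+1-3n]≡i+n+2 : ∀ {i} → i < h → (+ 2 ℤ.+ + i ℤ.+ ℤ.1ℤ ℤ.- + 3 ℤ.* + n) %ℕ p ≡ i + (L + 4)
  r[k+1-3n]≡i+n+2 {i} i<h = trans (i≡e+z*d⇒i%ℕd≡e%d _ (i + (L + 4)) ℤ.-1ℤ (k+1-3n≡[i+n+2]-p (+ i) (+ L))) (m<n⇒m%n≡m i+n+2<p)
    where
    k+1-3n≡[i+n+2]-p : ∀ i L → + 2 ℤ.+ i ℤ.+ ℤ.1ℤ ℤ.- + 3 ℤ.* (+ 2 ℤ.+ L)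
                       ≡ i ℤ.+ (L ℤ.+ + 4) ℤ.+ ℤ.-1ℤ ℤ.* (+ 3 ℤ.+ + 4 ℤ.* (ℤ.1ℤ ℤ.+ L))
    k+1-3n≡[i+n+2]-p = ℤ-solve-∀
    h+n+2+L≡p : ∀ L → 3 + 2 * L + (L + 4) + L ≡ 3 + 4 * suc L
    h+n+2+L≡p = solve-∀
    i+n+2<p : i + (L + 4) < p
    i+n+2<p = ≤-trans (+-monoˡ-< (L + 4) i<h) (subst (h + (L + 4) ≤_) (h+n+2+L≡p L) (m≤m+n _ L))

  ∣k-2n∣≡h∸[1+i] : ∀ {i} → i < h → ℤ.∣ + 2 ℤ.+ + i ℤ.- + (2 * n) ∣ ≡ h ∸ suc i
  ∣k-2n∣≡h∸[1+i] {i} i<h = trans (cong (λ x → ℤ.∣ (2 + i) ⊖ x ∣) 2n≡2+i+[h∸[1+i]]) (∣m⊖[m+n]∣≡n (2 + i) (h ∸ suc i))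
    where
    2n≡1+h : ∀ L → 2 * (2 + L) ≡ 1 + (3 + 2 * L)
    2n≡1+h = solve-∀
    2n≡2+i+[h∸[1+i]] : 2 * n ≡ 2 + i + (h ∸ suc i)
    2n≡2+i+[h∸[1+i]] = trans (2n≡1+h L) (cong suc (sym (m+[n∸m]≡n i<h)))

  ∑Γ′-lower : ∑[ i < h ] Γ′ p n (+ 2 ℤ.+ + i) ≡ ∑< h sq + (n + (∑< h id + h * (L + 4)))
  ∑Γ′-lower = begin
    ∑[ i < h ] (sq (suc i) + Y i)                   ≡⟨ ∑<-distrib-+ h (sq ∘ suc) Y ⟩
    ∑< h (sq ∘ suc) + ∑< h Y                        ≡⟨ cong₂ _+_ (∑<-suc h sq) (∑<-cong h r[k+1-3n]≡i+n+2) ⟩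
    (∑< h sq + sq h) + ∑[ i < h ] (i + (L + 4))     ≡⟨ cong₂ (λ x y → ∑< h sq + x + y) sq[h]≡n
                                                              (trans (∑<-distrib-+ h id (λ _ → L + 4)) (cong (λ x → ∑< h id + x) (∑<-const h (L + 4)))) ⟩
    (∑< h sq + n) + (∑< h id + h * (L + 4))         ≡⟨ +-assoc (∑< h sq) n _ ⟩
    ∑< h sq + (n + (∑< h id + h * (L + 4)))         ∎
    where
    open ≡-Reasoning
    Y : ℕ → ℕ
    Y i = (+ 2 ℤ.+ + i ℤ.+ ℤ.1ℤ ℤ.- + 3 ℤ.* + n) %ℕ p

  ∑[sq+1]-lower : ∑[ i < h ] (sq ℤ.∣ + 2 ℤ.+ + i ℤ.- + (2 * n) ∣ + 1) ≡ ∑< h sq + h * 1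
  ∑[sq+1]-lower = begin
    ∑[ i < h ] (sq ℤ.∣ + 2 ℤ.+ + i ℤ.- + (2 * n) ∣ + 1) ≡⟨ ∑<-cong h (λ i<h → cong (λ x → sq x + 1) (∣k-2n∣≡h∸[1+i] i<h)) ⟩
    ∑[ i < h ] (sq (h ∸ suc i) + 1)                     ≡⟨ ∑<-distrib-+ h (λ i → sq (h ∸ suc i)) (λ _ → 1) ⟩
    ∑[ i < h ] sq (h ∸ suc i) + ∑[ _ < h ] 1            ≡⟨ cong₂ _+_ (∑<-reverse h sq) (∑<-const h 1) ⟩
    ∑< h sq + h * 1                                     ∎
    where open ≡-Reasoning

  countΓ′-lower : countΓ′ p n (+ 2) (+ (2 * n)) ≡ n
  countΓ′-lower = [x+p*c]*2+y≡[x+p*d]*2+y⇒c≡d (h * 1) h (begin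
    (h * 1 + p * c) * 2 + h                   ≡⟨ cong (λ x → x * 2 + h) (sym n+∑≡h+p*c) ⟩
    (n + (∑< h id + h * (L + 4))) * 2 + h     ≡⟨ [x+[y+z]]*2+w≡[y*2+w]+[x+z]*2 n (∑< h id) (h * (L + 4)) h ⟩
    (∑< h id * 2 + h) + (n + h * (L + 4)) * 2 ≡⟨ cong (_+ (n + h * (L + 4)) * 2) (∑[i<m]i*2+m≡m*m h) ⟩
    h * h + (n + h * (L + 4)) * 2             ≡⟨ h*h+[n+h[L+4]]*2≡[h+p*n]*2+h L ⟩
    (h * 1 + p * n) * 2 + h                   ∎)
    where
    open ≡-Reasoning
    c : ℕ
    c = countΓ′ p n (+ 2) (+ (2 * n))

    2n+1≡2+h : ∀ L → 2 * (2 + L) + 1 ≡ 2 + (3 + 2 * L)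
    2n+1≡2+h = solve-∀

    n+∑≡h+p*c : n + (∑< h id + h * (L + 4)) ≡ h * 1 + p * c
    n+∑≡h+p*c = +-cancelˡ-≡ (∑< h sq) _ _ (begin
      ∑< h sq + (n + (∑< h id + h * (L + 4)))   ≡⟨ ∑Γ′-lower ⟨
      ∑[ i < h ] Γ′ p n (+ 2 ℤ.+ + i)           ≡⟨ ∑Γ′≡∑[sq+1]+p*countΓ′ 2 (2 * n) h (2n+1≡2+h L) ⟩
      ∑[ i < h ] (sq ℤ.∣ + 2 ℤ.+ + i ℤ.- + (2 * n) ∣ + 1) + p * c
                                                ≡⟨ cong (_+ p * c) ∑[sq+1]-lower ⟩
      ∑< h sq + h * 1 + p * c                   ≡⟨ +-assoc (∑< h sq) (h * 1) (p * c) ⟩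
      ∑< h sq + (h * 1 + p * c)                 ∎)

    [x+[y+z]]*2+w≡[y*2+w]+[x+z]*2 : ∀ x y z w → (x + (y + z)) * 2 + w ≡ (y * 2 + w) + (x + z) * 2
    [x+[y+z]]*2+w≡[y*2+w]+[x+z]*2 = solve-∀

    h*h+[n+h[L+4]]*2≡[h+p*n]*2+h : ∀ L → (3 + 2 * L) * (3 + 2 * L) + (2 + L + (3 + 2 * L) * (L + 4)) * 2
                                         ≡ ((3 + 2 * L) * 1 + (3 + 4 * suc L) * (2 + L)) * 2 + (3 + 2 * L)
    h*h+[n+h[L+4]]*2≡[h+p*n]*2+h = solve-∀

  sq[2n]≡n : sq (2 * n) ≡ n
  sq[2n]≡n = begin
    2 * n * (2 * n) % p      ≡⟨ cong (_% p) (2n*2n≡n+n*p L) ⟩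
    (n + n * p) % p          ≡⟨ [m+kn]%n≡m%n n n p ⟩
    n % p                    ≡⟨ m<n⇒m%n≡m n<p ⟩
    n                        ∎
    where
    open ≡-Reasoning
    2n*2n≡n+n*p : ∀ L → 2 * (2 + L) * (2 * (2 + L)) ≡ (2 + L) + (2 + L) * (3 + 4 * suc L)
    2n*2n≡n+n*p = solve-∀

  sq[2n+i]≡sq[2n∸[1+i]] : ∀ {i} → i < 2 * n → sq (2 * n + i) ≡ sq (2 * n ∸ suc i)
  sq[2n+i]≡sq[2n∸[1+i]] {i} i<2n = a+b≡p⇒sq[a]≡sq[b] (2 * n + i) w (suc-injective (begin
    suc (2 * n + i + w)  ≡⟨ x+[1+y]+z≡x+[1+y+z] (2 * n) i w ⟩
    2 * n + (suc i + w)  ≡⟨ cong (λ x → 2 * n + x) (m+[n∸m]≡n i<2n) ⟩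
    2 * n + 2 * n        ≡⟨ 2n+2n≡p+1 L ⟩
    suc p                ∎))
    where
    open ≡-Reasoning
    w : ℕ
    w = 2 * n ∸ suc i
    x+[1+y]+z≡x+[1+y+z] : ∀ x y z → suc (x + y + z) ≡ x + (suc y + z)
    x+[1+y]+z≡x+[1+y+z] = solve-∀
    2n+2n≡p+1 : ∀ L → 2 * (2 + L) + 2 * (2 + L) ≡ suc (3 + 4 * suc L)
    2n+2n≡p+1 = solve-∀

  r[k+1-3n]≡i+3n+1 : ∀ {i} → i < L → (+ suc (2 * n) ℤ.+ + i ℤ.+ ℤ.1ℤ ℤ.- + 3 ℤ.* + n) %ℕ p ≡ i + suc (3 * n)
  r[k+1-3n]≡i+3n+1 {i} i<L =
    trans (i≡e+z*d⇒i%ℕd≡e%d _ (i + suc (3 * n)) ℤ.-1ℤ (k+1-3n≡[i+3n+1]-p (+ i) (+ L))) (m<n⇒m%n≡m i+3n+1<p)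
    where
    k+1-3n≡[i+3n+1]-p : ∀ i L → ℤ.1ℤ ℤ.+ + 2 ℤ.* (+ 2 ℤ.+ L) ℤ.+ i ℤ.+ ℤ.1ℤ ℤ.- + 3 ℤ.* (+ 2 ℤ.+ L)
                        ≡ i ℤ.+ (ℤ.1ℤ ℤ.+ + 3 ℤ.* (+ 2 ℤ.+ L)) ℤ.+ ℤ.-1ℤ ℤ.* (+ 3 ℤ.+ + 4 ℤ.* (ℤ.1ℤ ℤ.+ L))
    k+1-3n≡[i+3n+1]-p = ℤ-solve-∀
    L+3n+1≡p : ∀ L → L + suc (3 * (2 + L)) ≡ 3 + 4 * suc L
    L+3n+1≡p = solve-∀
    i+3n+1<p : i + suc (3 * n) < p
    i+3n+1<p = subst (i + suc (3 * n) <_) (L+3n+1≡p L) (+-monoˡ-< (suc (3 * n)) i<L)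

  r[k+1-3n]≡t : ∀ {t} → t < 4 + L → (+ suc (2 * n) ℤ.+ + (L + t) ℤ.+ ℤ.1ℤ ℤ.- + 3 ℤ.* + n) %ℕ p ≡ t
  r[k+1-3n]≡t {t} t<4+L = trans (cong (_%ℕ p) (k+1-3n≡t (+ L) (+ t))) (m<n⇒m%n≡m (≤-trans t<4+L 4+L≤p))
    where
    k+1-3n≡t : ∀ L t → ℤ.1ℤ ℤ.+ + 2 ℤ.* (+ 2 ℤ.+ L) ℤ.+ (L ℤ.+ t) ℤ.+ ℤ.1ℤ ℤ.- + 3 ℤ.* (+ 2 ℤ.+ L) ≡ t
    k+1-3n≡t = ℤ-solve-∀
    4+L+[3+3L]≡p : ∀ L → 4 + L + (3 + 3 * L) ≡ 3 + 4 * suc L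
    4+L+[3+3L]≡p = solve-∀
    4+L≤p : 4 + L ≤ p
    4+L≤p = subst (4 + L ≤_) (4+L+[3+3L]≡p L) (m≤m+n (4 + L) (3 + 3 * L))

  ∣k-2n∣≡1+i : ∀ i → ℤ.∣ + suc (2 * n) ℤ.+ + i ℤ.- + (2 * n) ∣ ≡ suc i
  ∣k-2n∣≡1+i i = trans (cong (λ x → ℤ.∣ x ⊖ (2 * n) ∣) (sym (+-suc (2 * n) i))) (∣[m+n]⊖m∣≡n (2 * n) (suc i))

  ∑Γ′-upper : ∑[ i < 2 * n ] Γ′ p n (+ suc (2 * n) ℤ.+ + i)
              ≡ ∑< (2 * n) sq + (∑< L id + L * suc (3 * n) + ∑< (4 + L) id)
  ∑Γ′-upper = begin
    ∑[ i < 2 * n ] (sq (2 * n + i) + Y i)                     ≡⟨ ∑<-distrib-+ (2 * n) (λ i → sq (2 * n + i)) Y ⟩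
    ∑[ i < 2 * n ] sq (2 * n + i) + ∑< (2 * n) Y               ≡⟨ cong₂ _+_ ∑sq[2n+i]≡∑sq (cong (λ l → ∑< l Y) (2n≡L+[4+L] L)) ⟩
    ∑< (2 * n) sq + ∑< (L + (4 + L)) Y                         ≡⟨ cong (λ x → ∑< (2 * n) sq + x) (∑<-+ L (4 + L) Y) ⟩
    ∑< (2 * n) sq + (∑< L Y + ∑[ t < 4 + L ] Y (L + t))        ≡⟨ cong (λ x → ∑< (2 * n) sq + x) (cong₂ _+_ ∑Y-below (∑<-cong (4 + L) r[k+1-3n]≡t)) ⟩
    ∑< (2 * n) sq + (∑< L id + L * suc (3 * n) + ∑< (4 + L) id) ∎
    where
    open ≡-Reasoning
    Y : ℕ → ℕ
    Y i = (+ suc (2 * n) ℤ.+ + i ℤ.+ ℤ.1ℤ ℤ.- + 3 ℤ.* + n) %ℕ p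

    ∑sq[2n+i]≡∑sq : ∑[ i < 2 * n ] sq (2 * n + i) ≡ ∑< (2 * n) sq
    ∑sq[2n+i]≡∑sq = trans (∑<-cong (2 * n) sq[2n+i]≡sq[2n∸[1+i]]) (∑<-reverse (2 * n) sq)

    2n≡L+[4+L] : ∀ L → 2 * (2 + L) ≡ L + (4 + L)
    2n≡L+[4+L] = solve-∀

    ∑Y-below : ∑< L Y ≡ ∑< L id + L * suc (3 * n)
    ∑Y-below = trans (∑<-cong L r[k+1-3n]≡i+3n+1)
                     (trans (∑<-distrib-+ L id (λ _ → suc (3 * n))) (cong (λ x → ∑< L id + x) (∑<-const L (suc (3 * n)))))

  ∑[sq+1]-upper : ∑[ i < 2 * n ] (sq ℤ.∣ + suc (2 * n) ℤ.+ + i ℤ.- + (2 * n) ∣ + 1) ≡ ∑< (2 * n) sq + (n + 2 * n * 1)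
  ∑[sq+1]-upper = begin
    ∑[ i < 2 * n ] (sq ℤ.∣ + suc (2 * n) ℤ.+ + i ℤ.- + (2 * n) ∣ + 1) ≡⟨ ∑<-cong (2 * n) (λ {i} _ → cong (λ x → sq x + 1) (∣k-2n∣≡1+i i)) ⟩
    ∑[ i < 2 * n ] (sq (suc i) + 1)                          ≡⟨ ∑<-distrib-+ (2 * n) (sq ∘ suc) (λ _ → 1) ⟩
    ∑< (2 * n) (sq ∘ suc) + ∑[ _ < 2 * n ] 1                 ≡⟨ cong₂ _+_ (∑<-suc (2 * n) sq) (∑<-const (2 * n) 1) ⟩
    ∑< (2 * n) sq + sq (2 * n) + 2 * n * 1                   ≡⟨ cong (λ x → ∑< (2 * n) sq + x + 2 * n * 1) sq[2n]≡n ⟩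
    ∑< (2 * n) sq + n + 2 * n * 1                            ≡⟨ +-assoc (∑< (2 * n) sq) n _ ⟩
    ∑< (2 * n) sq + (n + 2 * n * 1)                          ∎
    where open ≡-Reasoning

  countΓ′-upper : countΓ′ p n (+ suc (2 * n)) (+ (4 * n)) ≡ L
  countΓ′-upper = [x+p*c]*2+y≡[x+p*d]*2+y⇒c≡d (n + 2 * n * 1) (L + (4 + L)) (begin
    (n + 2 * n * 1 + p * c) * 2 + (L + (4 + L))                 ≡⟨ cong (λ x → x * 2 + (L + (4 + L))) (sym ∑≡n+2n+p*c) ⟩
    (∑< L id + L * suc (3 * n) + ∑< (4 + L) id) * 2 + (L + (4 + L))
                                                                ≡⟨ [x+z+y]*2+[u+v]≡[x*2+u]+[y*2+v]+z*2 (∑< L id) (∑< (4 + L) id) (L * suc (3 * n)) L (4 + L) ⟩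
    (∑< L id * 2 + L) + (∑< (4 + L) id * 2 + (4 + L)) + L * suc (3 * n) * 2
                                                                ≡⟨ cong₂ (λ x y → x + y + L * suc (3 * n) * 2) (∑[i<m]i*2+m≡m*m L) (∑[i<m]i*2+m≡m*m (4 + L)) ⟩
    L * L + (4 + L) * (4 + L) + L * suc (3 * n) * 2             ≡⟨ L*L+[4+L]*[4+L]+L[3n+1]*2≡[n+2n+p*L]*2+[L+4+L] L ⟩
    (n + 2 * n * 1 + p * L) * 2 + (L + (4 + L))                 ∎)
    where
    open ≡-Reasoning
    c : ℕ
    c = countΓ′ p n (+ suc (2 * n)) (+ (4 * n))

    4n+1≡1+2n+2n : ∀ L → 4 * (2 + L) + 1 ≡ suc (2 * (2 + L)) + 2 * (2 + L)
    4n+1≡1+2n+2n = solve-∀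

    ∑≡n+2n+p*c : ∑< L id + L * suc (3 * n) + ∑< (4 + L) id ≡ n + 2 * n * 1 + p * c
    ∑≡n+2n+p*c = +-cancelˡ-≡ (∑< (2 * n) sq) _ _ (begin
      ∑< (2 * n) sq + (∑< L id + L * suc (3 * n) + ∑< (4 + L) id) ≡⟨ ∑Γ′-upper ⟨
      ∑[ i < 2 * n ] Γ′ p n (+ suc (2 * n) ℤ.+ + i)              ≡⟨ ∑Γ′≡∑[sq+1]+p*countΓ′ (suc (2 * n)) (4 * n) (2 * n) (4n+1≡1+2n+2n L) ⟩
      ∑[ i < 2 * n ] (sq ℤ.∣ + suc (2 * n) ℤ.+ + i ℤ.- + (2 * n) ∣ + 1) + p * c
                                                                 ≡⟨ cong (_+ p * c) ∑[sq+1]-upper ⟩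
      ∑< (2 * n) sq + (n + 2 * n * 1) + p * c                    ≡⟨ +-assoc (∑< (2 * n) sq) _ (p * c) ⟩
      ∑< (2 * n) sq + (n + 2 * n * 1 + p * c)                    ∎)

    [x+z+y]*2+[u+v]≡[x*2+u]+[y*2+v]+z*2 : ∀ x y z u v → (x + z + y) * 2 + (u + v) ≡ (x * 2 + u) + (y * 2 + v) + z * 2
    [x+z+y]*2+[u+v]≡[x*2+u]+[y*2+v]+z*2 = solve-∀

    L*L+[4+L]*[4+L]+L[3n+1]*2≡[n+2n+p*L]*2+[L+4+L] : ∀ L →
      L * L + (4 + L) * (4 + L) + L * suc (3 * (2 + L)) * 2
      ≡ (2 + L + 2 * (2 + L) * 1 + (3 + 4 * suc L) * L) * 2 + (L + (4 + L))
    L*L+[4+L]*[4+L]+L[3n+1]*2≡[n+2n+p*L]*2+[L+4+L] = solve-∀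

corollary4p7 : (n : ℕ) → 3 < n → Prime (4 * n ∸ 1) →
    (countΓ n (+ 2) (+ (2 * n)) ≡ n) × (countΓ n (+ suc (2 * n)) (+ (4 * n)) ≡ n ∸ 2)
corollary4p7 zero            ()       _
corollary4p7 (suc zero)      (s≤s ()) _
corollary4p7 n@(suc (suc L)) _        isPrime =
  trans (cong (λ q → countΓ′ q n (+ 2) (+ (2 * n))) 4n∸1≡p) countΓ′-lower ,
  trans (cong (λ q → countΓ′ q n (+ suc (2 * n)) (+ (4 * n))) 4n∸1≡p) countΓ′-upper
  where
  4n∸1≡p : 4 * n ∸ 1 ≡ 3 + 4 * suc L
  4n∸1≡p = cong (_∸ 1) (*-suc 4 (suc L))
  open Counts L (subst Prime 4n∸1≡p isPrime)
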